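{- Let $K>1$ be an integer. For $k\in[K]$ and $x\in[0,1]$ define $\alpha_k(x):=x^{k-1}\sum_{\ell=k}^K\binom{\ell-1}{k-1}(1-x)^{\ell-k}$. Then for all $x\in(0,1)$: (a) $(x\alpha_k(x))'>0$ for $1\le k\le K$; (b) $\alpha_k(x)>\alpha_{k+1}(x)$ for $1\le k<K$.
   Context: $[K]=\{1,\dots,K\}$. -}

module Defs where

open import Level using (Level; _⊔_)
open import Data.Nat using (ℕ; zero; suc; _∸_)
open import Data.Nat.Combinatorics using (_C_)
open import Data.List using (List; []; _∷_; map)
open import Data.Product using (∃)
open import Relation.Nullary using (¬_)
open import Relation.Binary.Core using (Rel)
open import Relation.Binary.Structures using (IsStrictTotalOrder)
open import Algebra.Bundles using (CommutativeRing)

-- An ordered field: a commutative ring with a strict total order compatible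
-- with + and *, in which every nonzero element has a multiplicative inverse.
-- (ℝ is the intended instance.)
record OrderedField (c ℓ₁ ℓ₂ : Level) : Set (Level.suc (c ⊔ ℓ₁ ⊔ ℓ₂)) where
  field
    commutativeRing : CommutativeRing c ℓ₁
  open CommutativeRing commutativeRing public
  field
    _<_                : Rel Carrier ℓ₂
    isStrictTotalOrder : IsStrictTotalOrder _≈_ _<_
    0<1                : 0# < 1#
    +-mono-<           : ∀ {x y} z → x < y → (x + z) < (y + z)
    *-pos              : ∀ {x y} → 0# < x → 0# < y → 0# < (x * y)
    inverse            : ∀ x → ¬ (x ≈ 0#) → ∃ λ y → (x * y) ≈ 1#

module Poly {c ℓ₁ ℓ₂} (F : OrderedField c ℓ₁ ℓ₂) where
  open OrderedField F public

  -- polynomials with coefficients in F, lowest degree first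
  Poly : Set c
  Poly = List Carrier

  natF : ℕ → Carrier
  natF zero    = 0#
  natF (suc n) = 1# + natF n

  addP : Poly → Poly → Poly
  addP []      q       = q
  addP (a ∷ p) []      = a ∷ p
  addP (a ∷ p) (b ∷ q) = (a + b) ∷ addP p q

  scaleP : Carrier → Poly → Poly
  scaleP a = map (a *_)

  mulP : Poly → Poly → Poly
  mulP []      q = []
  mulP (a ∷ p) q = addP (scaleP a q) (0# ∷ mulP p q)

  constP : Carrier → Poly
  constP a = a ∷ []

  X : Poly
  X = 0# ∷ 1# ∷ []

  oneMinusX : Poly
  oneMinusX = 1# ∷ (- 1#) ∷ []

  powP : Poly → ℕ → Poly
  powP p zero    = constP 1#
  powP p (suc n) = mulP p (powP p n)

  evalP : Poly → Carrier → Carrier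
  evalP []      x = 0#
  evalP (a ∷ p) x = a + (x * evalP p x)

  derivAux : ℕ → Poly → Poly
  derivAux i []      = []
  derivAux i (b ∷ q) = (natF i * b) ∷ derivAux (suc i) q

  derivP : Poly → Poly
  derivP []      = []
  derivP (a ∷ p) = derivAux 1 p

  sumFrom : (ℕ → Poly) → ℕ → ℕ → Poly
  sumFrom f a zero    = []
  sumFrom f a (suc n) = addP (f a) (sumFrom f (suc a) n)

  alpha : (K k : ℕ) → Poly
  alpha K k = mulP (powP X (k ∸ 1))
                   (sumFrom (λ l → scaleP (natF ((l ∸ 1) C (k ∸ 1))) (powP oneMinusX (l ∸ k)))
                            k (suc K ∸ k))

module Submission where

-- Write y = 1 - x and S m r = Σ_{j<r} C(m+j, j) yʲ (negBinomialSum), so that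
-- α_{m+1} = x^m S m (K - m).  Pascal's rule and x + y = 1 give
-- S m (n+1) = x S (m+1) n + C(m+1+n, n) yⁿ, hence α_k = α_{k+1} + C(K, k) x^{k-1} y^{K-k}.
-- The absorption identity j C(m+j, j) = (m+1) C(m+j, j-1) gives d/dx S m (n+1) = -(m+1) S (m+1) n,
-- and with the same recurrence the derivative of x α_k collapses to k C(K, k) x^{k-1} y^{K-k}.
-- Both right-hand sides are positive for 0 < x < 1.

open import Defs
open import Level using (Level)
open import Data.Nat using (ℕ; zero; suc; z≤n; s≤s; _∸_)
  renaming (_+_ to _+ℕ_; _*_ to _*ℕ_; _<_ to _<ℕ_; _≤_ to _≤ℕ_)
import Data.Nat.Properties as ℕ
open import Data.Nat.Combinatorics using (_C_; nCn≡1; nCk+nC[k+1]≡[n+1]C[k+1])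
open import Data.Nat.Tactic.RingSolver using (solve-∀)
open import Data.Fin using (toℕ)
open import Data.Fin.Properties using (toℕ-inject₁; toℕ-fromℕ)
open import Data.List using ([]; _∷_)
open import Data.Product using (_×_; _,_)
open import Function using (_∘_)
open import Relation.Binary.Structures using (IsStrictTotalOrder)
import Relation.Binary.PropositionalEquality as ≡
open ≡ using (_≡_)

-- pascal a b = (a + b) C a, defined by Pascal's rule so that proofs can follow it by induction.
pascal : ℕ → ℕ → ℕ
pascal a       zero    = 1
pascal zero    (suc b) = 1
pascal (suc a) (suc b) = pascal a (suc b) +ℕ pascal (suc a) b

module _ where
  open ≡.≡-Reasoning

  pascal≡C : ∀ a b → pascal a b ≡ (a +ℕ b) C a
  pascal≡C a       zero    = ≡.sym (≡.trans (≡.cong (_C a) (ℕ.+-identityʳ a)) (nCn≡1 a))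
  pascal≡C zero    (suc b) = ≡.refl
  pascal≡C (suc a) (suc b) = begin
    pascal a (suc b) +ℕ pascal (suc a) b
      ≡⟨ ≡.cong₂ _+ℕ_ (pascal≡C a (suc b))
                      (≡.trans (pascal≡C (suc a) b) (≡.cong (_C suc a) (≡.sym (ℕ.+-suc a b)))) ⟩
    (a +ℕ suc b) C a +ℕ (a +ℕ suc b) C suc a
      ≡⟨ nCk+nC[k+1]≡[n+1]C[k+1] (a +ℕ suc b) a ⟩
    (suc a +ℕ suc b) C suc a ∎

  pascal-positive : ∀ a b → 0 <ℕ pascal a b
  pascal-positive a       zero    = s≤s z≤n
  pascal-positive zero    (suc b) = s≤s z≤n
  pascal-positive (suc a) (suc b) = ℕ.<-≤-trans (pascal-positive a (suc b)) (ℕ.m≤m+n _ _)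

  pascal[a,1]≡1+a : ∀ a → pascal a 1 ≡ suc a
  pascal[a,1]≡1+a zero    = ≡.refl
  pascal[a,1]≡1+a (suc a) = ≡.trans (≡.cong (_+ℕ 1) (pascal[a,1]≡1+a a)) (ℕ.+-comm (suc a) 1)

  pascal[1,b]≡1+b : ∀ b → pascal 1 b ≡ suc b
  pascal[1,b]≡1+b zero    = ≡.refl
  pascal[1,b]≡1+b (suc b) = ≡.cong suc (pascal[1,b]≡1+b b)

  pascal-absorption : ∀ a b → suc b *ℕ pascal a (suc b) ≡ suc a *ℕ pascal (suc a) b
  pascal-absorption a zero = begin
    pascal a 1 +ℕ 0 ≡⟨ ℕ.+-identityʳ _ ⟩
    pascal a 1      ≡⟨ pascal[a,1]≡1+a a ⟩
    suc a           ≡⟨ ℕ.*-identityʳ (suc a) ⟨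
    suc a *ℕ 1      ∎
  pascal-absorption zero (suc b) = begin
    suc (suc b) *ℕ 1   ≡⟨ ℕ.*-identityʳ (suc (suc b)) ⟩
    suc (suc b)        ≡⟨ pascal[1,b]≡1+b (suc b) ⟨
    pascal 1 (suc b)   ≡⟨ ℕ.+-identityʳ _ ⟨
    1 *ℕ pascal 1 (suc b) ∎
  pascal-absorption (suc a) (suc b) = begin
    suc (suc b) *ℕ (P +ℕ Q)
      ≡⟨ ℕ.*-distribˡ-+ (suc (suc b)) P Q ⟩
    suc (suc b) *ℕ P +ℕ (Q +ℕ suc b *ℕ Q)
      ≡⟨ ≡.cong₂ (λ u v → u +ℕ (Q +ℕ v)) (pascal-absorption a (suc b)) (pascal-absorption (suc a) b) ⟩
    suc a *ℕ Q +ℕ (Q +ℕ suc (suc a) *ℕ R)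
      ≡⟨ regroup (suc a) Q R ⟩
    suc (suc a) *ℕ (Q +ℕ R) ∎
    where
    P = pascal a (suc (suc b))
    Q = pascal (suc a) (suc b)
    R = pascal (suc (suc a)) b
    regroup : ∀ c q r → c *ℕ q +ℕ (q +ℕ suc c *ℕ r) ≡ suc c *ℕ (q +ℕ r)
    regroup = solve-∀

module OrderedFieldProperties {c ℓ₁ ℓ₂} (F : OrderedField c ℓ₁ ℓ₂) where
  open Poly F
  open import Algebra.Properties.Semiring.Mult semiring using (×-homo-+; ×1-homo-*) renaming (_×_ to _·_)
  open import Algebra.Properties.Semiring.Exp semiring using (_^_)
  private module < = IsStrictTotalOrder isStrictTotalOrder

  private
    natF≡·1 : ∀ n → natF n ≡ n · 1#
    natF≡·1 zero    = ≡.refl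
    natF≡·1 (suc n) = ≡.cong (1# +_) (natF≡·1 n)

  natF-+ : ∀ m n → natF (m +ℕ n) ≈ natF m + natF n
  natF-+ m n rewrite natF≡·1 (m +ℕ n) | natF≡·1 m | natF≡·1 n = ×-homo-+ 1# m n

  natF-* : ∀ m n → natF (m *ℕ n) ≈ natF m * natF n
  natF-* m n rewrite natF≡·1 (m *ℕ n) | natF≡·1 m | natF≡·1 n = ×1-homo-* m n

  x<x+y : ∀ {a b} → 0# < b → a < (a + b)
  x<x+y {a} {b} 0<b = <.<-respˡ-≈ (+-identityˡ a) (<.<-respʳ-≈ (+-comm b a) (+-mono-< a 0<b))

  +-pos : ∀ {a b} → 0# < a → 0# < b → 0# < (a + b)
  +-pos 0<a 0<b = <.trans 0<a (x<x+y 0<b)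

  natF-pos : ∀ {n} → 0 <ℕ n → 0# < natF n
  natF-pos {suc zero}    _ = <.<-respʳ-≈ (sym (+-identityʳ 1#)) 0<1
  natF-pos {suc (suc n)} _ = +-pos 0<1 (natF-pos {suc n} (s≤s z≤n))

  ^-pos : ∀ {a} → 0# < a → ∀ n → 0# < (a ^ n)
  ^-pos 0<a zero    = 0<1
  ^-pos 0<a (suc n) = *-pos 0<a (^-pos 0<a n)

  1-x-pos : ∀ {a} → a < 1# → 0# < (1# - a)
  1-x-pos {a} a<1 = <.<-respˡ-≈ (-‿inverseʳ a) (+-mono-< (- a) a<1)

module Evaluation {c ℓ₁ ℓ₂} (F : OrderedField c ℓ₁ ℓ₂) (x : OrderedField.Carrier F) where
  open Poly F
  open import Algebra.Properties.Semiring.Exp semiring using (_^_; ^-congˡ)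
  open import Algebra.Properties.Ring ring using (-‿distribʳ-*)
  open import Algebra.Solver.Ring.NaturalCoefficients.Default commutativeSemiring
    using (solve; _:=_; _:+_; _:*_; con)
  open import Relation.Binary.Reasoning.Setoid setoid

  ⟦_⟧ : Poly → Carrier
  ⟦ p ⟧ = evalP p x

  ⟦_⟧′ : Poly → Carrier
  ⟦ p ⟧′ = evalP (derivP p) x

  eval-add : ∀ p q → ⟦ addP p q ⟧ ≈ ⟦ p ⟧ + ⟦ q ⟧
  eval-add []      q       = sym (+-identityˡ _)
  eval-add (a ∷ p) []      = sym (+-identityʳ _)
  eval-add (a ∷ p) (b ∷ q) = begin
    (a + b) + x * ⟦ addP p q ⟧
      ≈⟨ +-congˡ (*-congˡ (eval-add p q)) ⟩
    (a + b) + x * (⟦ p ⟧ + ⟦ q ⟧)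
      ≈⟨ solve 5 (λ a b x u v → (a :+ b) :+ x :* (u :+ v) := (a :+ x :* u) :+ (b :+ x :* v))
               refl a b x ⟦ p ⟧ ⟦ q ⟧ ⟩
    (a + x * ⟦ p ⟧) + (b + x * ⟦ q ⟧) ∎

  eval-scale : ∀ a p → ⟦ scaleP a p ⟧ ≈ a * ⟦ p ⟧
  eval-scale a []      = sym (zeroʳ a)
  eval-scale a (b ∷ p) = begin
    a * b + x * ⟦ scaleP a p ⟧
      ≈⟨ +-congˡ (*-congˡ (eval-scale a p)) ⟩
    a * b + x * (a * ⟦ p ⟧)
      ≈⟨ solve 4 (λ a b x u → a :* b :+ x :* (a :* u) := a :* (b :+ x :* u)) refl a b x ⟦ p ⟧ ⟩
    a * (b + x * ⟦ p ⟧) ∎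

  eval-mul : ∀ p q → ⟦ mulP p q ⟧ ≈ ⟦ p ⟧ * ⟦ q ⟧
  eval-mul []      q = sym (zeroˡ _)
  eval-mul (a ∷ p) q = begin
    ⟦ addP (scaleP a q) (0# ∷ mulP p q) ⟧
      ≈⟨ eval-add (scaleP a q) (0# ∷ mulP p q) ⟩
    ⟦ scaleP a q ⟧ + (0# + x * ⟦ mulP p q ⟧)
      ≈⟨ +-cong (eval-scale a q) (+-congˡ (*-congˡ (eval-mul p q))) ⟩
    a * ⟦ q ⟧ + (0# + x * (⟦ p ⟧ * ⟦ q ⟧))
      ≈⟨ solve 4 (λ a x u v → a :* v :+ (con 0 :+ x :* (u :* v)) := (a :+ x :* u) :* v) refl a x ⟦ p ⟧ ⟦ q ⟧ ⟩
    (a + x * ⟦ p ⟧) * ⟦ q ⟧ ∎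

  eval-const : ∀ a → ⟦ constP a ⟧ ≈ a
  eval-const a = trans (+-congˡ (zeroʳ x)) (+-identityʳ a)

  eval-pow : ∀ p n → ⟦ powP p n ⟧ ≈ ⟦ p ⟧ ^ n
  eval-pow p zero    = eval-const 1#
  eval-pow p (suc n) = trans (eval-mul p (powP p n)) (*-congˡ (eval-pow p n))

  eval-X : ⟦ X ⟧ ≈ x
  eval-X = solve 1 (λ x → con 0 :+ x :* (con 1 :+ x :* con 0) := x) refl x

  eval-powX : ∀ m → ⟦ powP X m ⟧ ≈ x ^ m
  eval-powX m = trans (eval-pow X m) (^-congˡ m eval-X)

  eval-oneMinusX : ⟦ oneMinusX ⟧ ≈ 1# - x
  eval-oneMinusX = +-congˡ (begin
    x * (- 1# + x * 0#) ≈⟨ *-congˡ (trans (+-congˡ (zeroʳ x)) (+-identityʳ (- 1#))) ⟩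
    x * - 1#            ≈⟨ -‿distribʳ-* x 1# ⟨
    - (x * 1#)          ≈⟨ -‿cong (*-identityʳ x) ⟩
    - x                 ∎)

  deriv-cons : ∀ a p → ⟦ a ∷ p ⟧′ ≈ ⟦ p ⟧ + x * ⟦ p ⟧′
  deriv-cons a p = trans (derivAux-suc 0 p) (trans (+-congʳ (derivAux-zero p)) (+-comm _ _))
    where
    derivAux-suc : ∀ i q → evalP (derivAux (suc i) q) x ≈ evalP (derivAux i q) x + ⟦ q ⟧
    derivAux-suc i []      = sym (+-identityʳ _)
    derivAux-suc i (b ∷ q) = begin
      (1# + natF i) * b + x * evalP (derivAux (suc (suc i)) q) x
        ≈⟨ +-congˡ (*-congˡ (derivAux-suc (suc i) q)) ⟩
      (1# + natF i) * b + x * (evalP (derivAux (suc i) q) x + ⟦ q ⟧)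
        ≈⟨ solve 5 (λ n b x d e → (con 1 :+ n) :* b :+ x :* (d :+ e) := (n :* b :+ x :* d) :+ (b :+ x :* e))
                 refl (natF i) b x _ ⟦ q ⟧ ⟩
      (natF i * b + x * evalP (derivAux (suc i) q) x) + (b + x * ⟦ q ⟧) ∎
    derivAux-zero : ∀ q → evalP (derivAux 0 q) x ≈ x * ⟦ q ⟧′
    derivAux-zero []      = sym (zeroʳ x)
    derivAux-zero (b ∷ q) = solve 3 (λ b x d → con 0 :* b :+ x :* d := x :* d) refl b x _

  deriv-add : ∀ p q → ⟦ addP p q ⟧′ ≈ ⟦ p ⟧′ + ⟦ q ⟧′
  deriv-add []      q       = sym (+-identityˡ _)
  deriv-add (a ∷ p) []      = sym (+-identityʳ _)
  deriv-add (a ∷ p) (b ∷ q) = begin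
    ⟦ (a + b) ∷ addP p q ⟧′
      ≈⟨ deriv-cons (a + b) (addP p q) ⟩
    ⟦ addP p q ⟧ + x * ⟦ addP p q ⟧′
      ≈⟨ +-cong (eval-add p q) (*-congˡ (deriv-add p q)) ⟩
    (⟦ p ⟧ + ⟦ q ⟧) + x * (⟦ p ⟧′ + ⟦ q ⟧′)
      ≈⟨ solve 5 (λ x u v s t → (u :+ v) :+ x :* (s :+ t) := (u :+ x :* s) :+ (v :+ x :* t))
               refl x ⟦ p ⟧ ⟦ q ⟧ ⟦ p ⟧′ ⟦ q ⟧′ ⟩
    (⟦ p ⟧ + x * ⟦ p ⟧′) + (⟦ q ⟧ + x * ⟦ q ⟧′)
      ≈⟨ +-cong (deriv-cons a p) (deriv-cons b q) ⟨
    ⟦ a ∷ p ⟧′ + ⟦ b ∷ q ⟧′ ∎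

  deriv-scale : ∀ a p → ⟦ scaleP a p ⟧′ ≈ a * ⟦ p ⟧′
  deriv-scale a []      = sym (zeroʳ a)
  deriv-scale a (b ∷ p) = begin
    ⟦ a * b ∷ scaleP a p ⟧′
      ≈⟨ deriv-cons (a * b) (scaleP a p) ⟩
    ⟦ scaleP a p ⟧ + x * ⟦ scaleP a p ⟧′
      ≈⟨ +-cong (eval-scale a p) (*-congˡ (deriv-scale a p)) ⟩
    a * ⟦ p ⟧ + x * (a * ⟦ p ⟧′)
      ≈⟨ solve 4 (λ a x u v → a :* u :+ x :* (a :* v) := a :* (u :+ x :* v)) refl a x ⟦ p ⟧ ⟦ p ⟧′ ⟩
    a * (⟦ p ⟧ + x * ⟦ p ⟧′)
      ≈⟨ *-congˡ (deriv-cons b p) ⟨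
    a * ⟦ b ∷ p ⟧′ ∎

  deriv-mul : ∀ p q → ⟦ mulP p q ⟧′ ≈ ⟦ p ⟧′ * ⟦ q ⟧ + ⟦ p ⟧ * ⟦ q ⟧′
  deriv-mul []      q = solve 2 (λ u v → con 0 := con 0 :* u :+ con 0 :* v) refl ⟦ q ⟧ ⟦ q ⟧′
  deriv-mul (a ∷ p) q = begin
    ⟦ addP (scaleP a q) (0# ∷ mulP p q) ⟧′
      ≈⟨ deriv-add (scaleP a q) (0# ∷ mulP p q) ⟩
    ⟦ scaleP a q ⟧′ + ⟦ 0# ∷ mulP p q ⟧′
      ≈⟨ +-cong (deriv-scale a q) (deriv-cons 0# (mulP p q)) ⟩
    a * ⟦ q ⟧′ + (⟦ mulP p q ⟧ + x * ⟦ mulP p q ⟧′)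
      ≈⟨ +-congˡ (+-cong (eval-mul p q) (*-congˡ (deriv-mul p q))) ⟩
    a * ⟦ q ⟧′ + (⟦ p ⟧ * ⟦ q ⟧ + x * (⟦ p ⟧′ * ⟦ q ⟧ + ⟦ p ⟧ * ⟦ q ⟧′))
      ≈⟨ solve 6 (λ a x u v s t → a :* t :+ (u :* v :+ x :* (s :* v :+ u :* t))
                                := (u :+ x :* s) :* v :+ (a :+ x :* u) :* t)
               refl a x ⟦ p ⟧ ⟦ q ⟧ ⟦ p ⟧′ ⟦ q ⟧′ ⟩
    (⟦ p ⟧ + x * ⟦ p ⟧′) * ⟦ q ⟧ + (a + x * ⟦ p ⟧) * ⟦ q ⟧′
      ≈⟨ +-congʳ (*-congʳ (deriv-cons a p)) ⟨
    ⟦ a ∷ p ⟧′ * ⟦ q ⟧ + ⟦ a ∷ p ⟧ * ⟦ q ⟧′ ∎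

  deriv-pow : ∀ p n → ⟦ powP p (suc n) ⟧′ ≈ natF (suc n) * (⟦ p ⟧ ^ n * ⟦ p ⟧′)
  deriv-pow p zero    = begin
    ⟦ mulP p (constP 1#) ⟧′
      ≈⟨ deriv-mul p (constP 1#) ⟩
    ⟦ p ⟧′ * ⟦ constP 1# ⟧ + ⟦ p ⟧ * 0#
      ≈⟨ +-congʳ (*-congˡ (eval-const 1#)) ⟩
    ⟦ p ⟧′ * 1# + ⟦ p ⟧ * 0#
      ≈⟨ solve 2 (λ u d → d :* con 1 :+ u :* con 0 := (con 1 :+ con 0) :* (con 1 :* d)) refl ⟦ p ⟧ ⟦ p ⟧′ ⟩
    (1# + 0#) * (1# * ⟦ p ⟧′) ∎
  deriv-pow p (suc n) = begin
    ⟦ mulP p (powP p (suc n)) ⟧′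
      ≈⟨ deriv-mul p (powP p (suc n)) ⟩
    ⟦ p ⟧′ * ⟦ powP p (suc n) ⟧ + ⟦ p ⟧ * ⟦ powP p (suc n) ⟧′
      ≈⟨ +-cong (*-congˡ (eval-pow p (suc n))) (*-congˡ (deriv-pow p n)) ⟩
    ⟦ p ⟧′ * (⟦ p ⟧ * ⟦ p ⟧ ^ n) + ⟦ p ⟧ * (natF (suc n) * (⟦ p ⟧ ^ n * ⟦ p ⟧′))
      ≈⟨ solve 4 (λ u d w k → d :* (u :* w) :+ u :* (k :* (w :* d)) := (con 1 :+ k) :* ((u :* w) :* d))
               refl ⟦ p ⟧ ⟦ p ⟧′ (⟦ p ⟧ ^ n) (natF (suc n)) ⟩
    natF (suc (suc n)) * (⟦ p ⟧ ^ suc n * ⟦ p ⟧′) ∎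

  deriv-X : ⟦ X ⟧′ ≈ 1#
  deriv-X = solve 1 (λ x → (con 1 :+ con 0) :* con 1 :+ x :* con 0 := con 1) refl x

  deriv-oneMinusX : ⟦ oneMinusX ⟧′ ≈ - 1#
  deriv-oneMinusX = begin
    (1# + 0#) * - 1# + x * 0# ≈⟨ +-congˡ (zeroʳ x) ⟩
    (1# + 0#) * - 1# + 0#     ≈⟨ +-identityʳ _ ⟩
    (1# + 0#) * - 1#          ≈⟨ *-congʳ (+-identityʳ 1#) ⟩
    1# * - 1#                 ≈⟨ *-identityˡ (- 1#) ⟩
    - 1#                      ∎

  x*deriv-powX : ∀ m → x * ⟦ powP X m ⟧′ ≈ natF m * x ^ m
  x*deriv-powX zero    = trans (zeroʳ x) (sym (zeroˡ 1#))
  x*deriv-powX (suc m) = begin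
    x * ⟦ powP X (suc m) ⟧′
      ≈⟨ *-congˡ (deriv-pow X m) ⟩
    x * (natF (suc m) * (⟦ X ⟧ ^ m * ⟦ X ⟧′))
      ≈⟨ *-congˡ (*-congˡ (*-cong (^-congˡ m eval-X) deriv-X)) ⟩
    x * (natF (suc m) * (x ^ m * 1#))
      ≈⟨ solve 3 (λ x k w → x :* (k :* (w :* con 1)) := k :* (x :* w)) refl x (natF (suc m)) (x ^ m) ⟩
    natF (suc m) * x ^ suc m ∎

  deriv-X*powX* : ∀ m q → ⟦ mulP X (mulP (powP X m) q) ⟧′ ≈ natF (suc m) * x ^ m * ⟦ q ⟧ + x ^ suc m * ⟦ q ⟧′
  deriv-X*powX* m q = begin
    ⟦ mulP X (mulP (powP X m) q) ⟧′
      ≈⟨ deriv-mul X (mulP (powP X m) q) ⟩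
    ⟦ X ⟧′ * ⟦ mulP (powP X m) q ⟧ + ⟦ X ⟧ * ⟦ mulP (powP X m) q ⟧′
      ≈⟨ +-cong (*-cong deriv-X (eval-mul (powP X m) q)) (*-cong eval-X (deriv-mul (powP X m) q)) ⟩
    1# * (⟦ powP X m ⟧ * ⟦ q ⟧) + x * (⟦ powP X m ⟧′ * ⟦ q ⟧ + ⟦ powP X m ⟧ * ⟦ q ⟧′)
      ≈⟨ solve 5 (λ x w d e f → con 1 :* (w :* e) :+ x :* (d :* e :+ w :* f)
                              := w :* e :+ (x :* d) :* e :+ x :* w :* f)
               refl x ⟦ powP X m ⟧ ⟦ powP X m ⟧′ ⟦ q ⟧ ⟦ q ⟧′ ⟩
    ⟦ powP X m ⟧ * ⟦ q ⟧ + (x * ⟦ powP X m ⟧′) * ⟦ q ⟧ + x * ⟦ powP X m ⟧ * ⟦ q ⟧′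
      ≈⟨ +-cong (+-cong (*-congʳ (eval-powX m)) (*-congʳ (x*deriv-powX m))) (*-congʳ (*-congˡ (eval-powX m))) ⟩
    x ^ m * ⟦ q ⟧ + natF m * x ^ m * ⟦ q ⟧ + x * x ^ m * ⟦ q ⟧′
      ≈⟨ solve 5 (λ x w k e f → w :* e :+ k :* w :* e :+ x :* w :* f := (con 1 :+ k) :* w :* e :+ x :* w :* f)
               refl x (x ^ m) (natF m) ⟦ q ⟧ ⟦ q ⟧′ ⟩
    natF (suc m) * x ^ m * ⟦ q ⟧ + x ^ suc m * ⟦ q ⟧′ ∎

module Alpha {c ℓ₁ ℓ₂} (F : OrderedField c ℓ₁ ℓ₂) where
  open Poly F
  open import Algebra.Properties.Semiring.Sum semiring using (sum-syntax; sum-cong-≋)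

  sumFrom-hom : (h : Poly → Carrier) → h [] ≈ 0# → (∀ p q → h (addP p q) ≈ h p + h q) →
                ∀ f a r → h (sumFrom f a r) ≈ ∑[ i < r ] h (f (a +ℕ toℕ i))
  sumFrom-hom h h-[] h-add f a zero    = h-[]
  sumFrom-hom h h-[] h-add f a (suc r) = trans (h-add (f a) (sumFrom f (suc a) r)) (+-cong
    (reflexive (≡.cong (h ∘ f) (≡.sym (ℕ.+-identityʳ a))))
    (trans (sumFrom-hom h h-[] h-add f (suc a) r)
           (sum-cong-≋ {r} (λ i → reflexive (≡.cong (h ∘ f) (≡.sym (ℕ.+-suc a (toℕ i))))))))

  summand : ℕ → ℕ → Poly
  summand m l = scaleP (natF ((l ∸ 1) C m)) (powP oneMinusX (l ∸ suc m))

  summand-shift : ∀ m j → summand m (suc m +ℕ j) ≡ scaleP (natF (pascal m j)) (powP oneMinusX j)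
  summand-shift m j =
    ≡.cong₂ (λ a b → scaleP (natF a) (powP oneMinusX b)) (≡.sym (pascal≡C m j)) (ℕ.m+n∸m≡n m j)

  alpha-split : ∀ m r {K} → m +ℕ r ≡ K → alpha K (suc m) ≡ mulP (powP X m) (sumFrom (summand m) (suc m) r)
  alpha-split m r ≡.refl = ≡.cong (mulP (powP X m) ∘ sumFrom (summand m) (suc m)) (ℕ.m+n∸m≡n m r)

module NegativeBinomial {c ℓ₁ ℓ₂} (F : OrderedField c ℓ₁ ℓ₂) (x : OrderedField.Carrier F) where
  open Poly F
  open OrderedFieldProperties F
  open Evaluation F x
  open Alpha F
  open import Algebra.Properties.Semiring.Exp semiring using (_^_; ^-congˡ)
  open import Algebra.Properties.Semiring.Sum semiring
    using (sum-syntax; sum-cong-≋; sum-init-last; *-distribˡ-sum)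
  open import Algebra.Properties.Ring ring using (-‿distribˡ-*; -‿distribʳ-*; -1*x≈-x)
  open import Algebra.Properties.Group +-group using (//-rightDividesˡ; //-rightDividesʳ)
  open import Algebra.Solver.Ring.NaturalCoefficients.Default commutativeSemiring
    using (solve; _:=_; _:+_; _:*_; con)
  open import Relation.Binary.Reasoning.Setoid setoid
  private module < = IsStrictTotalOrder isStrictTotalOrder

  y : Carrier
  y = 1# - x

  x+y≈1 : x + y ≈ 1#
  x+y≈1 = trans (+-comm x y) (//-rightDividesˡ x 1#)

  term : ℕ → ℕ → Carrier
  term m j = natF (pascal m j) * y ^ j

  negBinomialSum : ℕ → ℕ → Carrier
  negBinomialSum m r = ∑[ i < r ] term m (toℕ i)

  negBinomialSum-suc : ∀ m r → negBinomialSum m (suc r) ≈ negBinomialSum m r + term m r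
  negBinomialSum-suc m r = trans (sum-init-last {r} (λ i → term m (toℕ i))) (+-cong
    (sum-cong-≋ {r} (λ i → reflexive (≡.cong (term m) (toℕ-inject₁ i))))
    (reflexive (≡.cong (term m) (toℕ-fromℕ r))))

  term-pascal : ∀ m n → term m (suc n) + y * term (suc m) n ≈ term (suc m) (suc n)
  term-pascal m n = begin
    natF P * (y * y ^ n) + y * (natF Q * y ^ n)
      ≈⟨ solve 4 (λ p q y w → p :* (y :* w) :+ y :* (q :* w) := (p :+ q) :* (y :* w)) refl (natF P) (natF Q) y (y ^ n) ⟩
    (natF P + natF Q) * (y * y ^ n)
      ≈⟨ *-congʳ (natF-+ P Q) ⟨
    natF (P +ℕ Q) * y ^ suc n ∎
    where
    P = pascal m (suc n)
    Q = pascal (suc m) n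

  negBinomialSum-pascal : ∀ m n → negBinomialSum m (suc n) ≈ x * negBinomialSum (suc m) n + term (suc m) n
  negBinomialSum-pascal m zero    =
    solve 1 (λ x → (con 1 :+ con 0) :* con 1 :+ con 0 := x :* con 0 :+ (con 1 :+ con 0) :* con 1) refl x
  negBinomialSum-pascal m (suc n) = begin
    negBinomialSum m (suc (suc n))
      ≈⟨ negBinomialSum-suc m (suc n) ⟩
    negBinomialSum m (suc n) + term m (suc n)
      ≈⟨ +-congʳ (negBinomialSum-pascal m n) ⟩
    x * S + t + term m (suc n)
      ≈⟨ +-congʳ (+-congˡ (trans (*-congʳ x+y≈1) (*-identityˡ t))) ⟨
    x * S + (x + y) * t + term m (suc n)
      ≈⟨ solve 5 (λ x y s t u → x :* s :+ (x :+ y) :* t :+ u := x :* (s :+ t) :+ (u :+ y :* t))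
               refl x y S t (term m (suc n)) ⟩
    x * (S + t) + (term m (suc n) + y * t)
      ≈⟨ +-cong (*-congˡ (sym (negBinomialSum-suc (suc m) n))) (term-pascal m n) ⟩
    x * negBinomialSum (suc m) (suc n) + term (suc m) (suc n) ∎
    where
    S = negBinomialSum (suc m) n
    t = term (suc m) n

  eval-series : ∀ m r → ⟦ sumFrom (summand m) (suc m) r ⟧ ≈ negBinomialSum m r
  eval-series m r = trans (sumFrom-hom ⟦_⟧ refl eval-add (summand m) (suc m) r) (sum-cong-≋ {r} eval-summand)
    where
    eval-summand : ∀ i → ⟦ summand m (suc m +ℕ toℕ i) ⟧ ≈ term m (toℕ i)
    eval-summand i = begin
      ⟦ summand m (suc m +ℕ toℕ i) ⟧
        ≡⟨ ≡.cong ⟦_⟧ (summand-shift m (toℕ i)) ⟩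
      ⟦ scaleP (natF (pascal m (toℕ i))) (powP oneMinusX (toℕ i)) ⟧
        ≈⟨ eval-scale (natF (pascal m (toℕ i))) (powP oneMinusX (toℕ i)) ⟩
      natF (pascal m (toℕ i)) * ⟦ powP oneMinusX (toℕ i) ⟧
        ≈⟨ *-congˡ (trans (eval-pow oneMinusX (toℕ i)) (^-congˡ (toℕ i) eval-oneMinusX)) ⟩
      term m (toℕ i) ∎

  deriv-term : ∀ m j → natF (pascal m (suc j)) * ⟦ powP oneMinusX (suc j) ⟧′ ≈ - natF (suc m) * term (suc m) j
  deriv-term m j = begin
    natF P * ⟦ powP oneMinusX (suc j) ⟧′
      ≈⟨ *-congˡ (trans (deriv-pow oneMinusX j) (*-congˡ (*-cong (^-congˡ j eval-oneMinusX) deriv-oneMinusX))) ⟩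
    natF P * (natF (suc j) * (y ^ j * - 1#))
      ≈⟨ solve 4 (λ a b w n → a :* (b :* (w :* n)) := n :* (b :* a) :* w) refl (natF P) (natF (suc j)) (y ^ j) (- 1#) ⟩
    - 1# * (natF (suc j) * natF P) * y ^ j
      ≈⟨ *-congʳ (*-congˡ absorption) ⟩
    - 1# * (natF (suc m) * natF Q) * y ^ j
      ≈⟨ solve 4 (λ n c q w → n :* (c :* q) :* w := (n :* c) :* (q :* w)) refl (- 1#) (natF (suc m)) (natF Q) (y ^ j) ⟩
    - 1# * natF (suc m) * term (suc m) j
      ≈⟨ *-congʳ (-1*x≈-x (natF (suc m))) ⟩
    - natF (suc m) * term (suc m) j ∎
    where
    P = pascal m (suc j)
    Q = pascal (suc m) j
    absorption : natF (suc j) * natF P ≈ natF (suc m) * natF Q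
    absorption = begin
      natF (suc j) * natF P   ≈⟨ natF-* (suc j) P ⟨
      natF (suc j *ℕ P)       ≡⟨ ≡.cong natF (pascal-absorption m j) ⟩
      natF (suc m *ℕ Q)       ≈⟨ natF-* (suc m) Q ⟩
      natF (suc m) * natF Q   ∎

  deriv-series : ∀ m n → ⟦ sumFrom (summand m) (suc m) (suc n) ⟧′ ≈ - natF (suc m) * negBinomialSum (suc m) n
  deriv-series m n = begin
    ⟦ sumFrom (summand m) (suc m) (suc n) ⟧′
      ≈⟨ sumFrom-hom ⟦_⟧′ refl deriv-add (summand m) (suc m) (suc n) ⟩
    ∑[ i < suc n ] ⟦ summand m (suc m +ℕ toℕ i) ⟧′
      ≈⟨ sum-cong-≋ {suc n} deriv-summand ⟩
    natF (pascal m 0) * 0# + ∑[ i < n ] (natF (pascal m (suc (toℕ i))) * ⟦ powP oneMinusX (suc (toℕ i)) ⟧′)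
      ≈⟨ +-cong (zeroʳ _) (sum-cong-≋ {n} (λ i → deriv-term m (toℕ i))) ⟩
    0# + ∑[ i < n ] (- natF (suc m) * term (suc m) (toℕ i))
      ≈⟨ +-identityˡ _ ⟩
    ∑[ i < n ] (- natF (suc m) * term (suc m) (toℕ i))
      ≈⟨ *-distribˡ-sum {n} (- natF (suc m)) (λ i → term (suc m) (toℕ i)) ⟨
    - natF (suc m) * negBinomialSum (suc m) n ∎
    where
    deriv-summand : ∀ i → ⟦ summand m (suc m +ℕ toℕ i) ⟧′ ≈ natF (pascal m (toℕ i)) * ⟦ powP oneMinusX (toℕ i) ⟧′
    deriv-summand i = trans (reflexive (≡.cong ⟦_⟧′ (summand-shift m (toℕ i))))
                            (deriv-scale (natF (pascal m (toℕ i))) (powP oneMinusX (toℕ i)))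

  alpha-step : ∀ m n → ⟦ alpha (suc m +ℕ n) (suc m) ⟧ ≈ ⟦ alpha (suc m +ℕ n) (suc (suc m)) ⟧ + x ^ m * term (suc m) n
  alpha-step m n = begin
    ⟦ alpha (suc m +ℕ n) (suc m) ⟧
      ≡⟨ ≡.cong ⟦_⟧ (alpha-split m (suc n) (ℕ.+-suc m n)) ⟩
    ⟦ mulP (powP X m) (sumFrom (summand m) (suc m) (suc n)) ⟧
      ≈⟨ trans (eval-mul (powP X m) _) (*-cong (eval-powX m) (eval-series m (suc n))) ⟩
    x ^ m * negBinomialSum m (suc n)
      ≈⟨ *-congˡ (negBinomialSum-pascal m n) ⟩
    x ^ m * (x * S + t)
      ≈⟨ solve 4 (λ w x s t → w :* (x :* s :+ t) := x :* w :* s :+ w :* t) refl (x ^ m) x S t ⟩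
    x ^ suc m * S + x ^ m * t
      ≈⟨ +-congʳ (trans (eval-mul (powP X (suc m)) _) (*-cong (eval-powX (suc m)) (eval-series (suc m) n))) ⟨
    ⟦ mulP (powP X (suc m)) (sumFrom (summand (suc m)) (suc (suc m)) n) ⟧ + x ^ m * t
      ≡⟨ ≡.cong (λ p → ⟦ p ⟧ + x ^ m * t) (alpha-split (suc m) n ≡.refl) ⟨
    ⟦ alpha (suc m +ℕ n) (suc (suc m)) ⟧ + x ^ m * t ∎
    where
    S = negBinomialSum (suc m) n
    t = term (suc m) n

  deriv-X*alpha : ∀ m n → ⟦ mulP X (alpha (suc m +ℕ n) (suc m)) ⟧′ ≈ natF (suc m) * x ^ m * term (suc m) n
  deriv-X*alpha m n = begin
    ⟦ mulP X (alpha (suc m +ℕ n) (suc m)) ⟧′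
      ≡⟨ ≡.cong (λ p → ⟦ mulP X p ⟧′) (alpha-split m (suc n) (ℕ.+-suc m n)) ⟩
    ⟦ mulP X (mulP (powP X m) series) ⟧′
      ≈⟨ deriv-X*powX* m series ⟩
    k * x ^ m * ⟦ series ⟧ + x ^ suc m * ⟦ series ⟧′
      ≈⟨ +-cong (*-congˡ (trans (eval-series m (suc n)) (negBinomialSum-pascal m n))) (*-congˡ (deriv-series m n)) ⟩
    k * x ^ m * (x * S + t) + x ^ suc m * (- k * S)
      ≈⟨ +-congˡ (trans (*-congˡ (sym (-‿distribˡ-* k S))) (sym (-‿distribʳ-* (x ^ suc m) (k * S)))) ⟩
    k * x ^ m * (x * S + t) + - (x ^ suc m * (k * S))
      ≈⟨ +-congʳ (solve 5 (λ k w x s t → k :* w :* (x :* s :+ t) := k :* w :* t :+ x :* w :* (k :* s))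
                          refl k (x ^ m) x S t) ⟩
    k * x ^ m * t + x ^ suc m * (k * S) + - (x ^ suc m * (k * S))
      ≈⟨ //-rightDividesʳ (x ^ suc m * (k * S)) (k * x ^ m * t) ⟩
    k * x ^ m * t ∎
    where
    series = sumFrom (summand m) (suc m) (suc n)
    k = natF (suc m)
    S = negBinomialSum (suc m) n
    t = term (suc m) n

  module _ (0<x : 0# < x) (x<1 : x < 1#) where

    term-pos : ∀ m j → 0# < term m j
    term-pos m j = *-pos (natF-pos (pascal-positive m j)) (^-pos (1-x-pos x<1) j)

    X*alpha-deriv-pos : ∀ {K m} → suc m ≤ℕ K → 0# < ⟦ mulP X (alpha K (suc m)) ⟧′
    X*alpha-deriv-pos {m = m} k≤K with ℕ.m≤n⇒∃[o]m+o≡n k≤K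
    ... | n , ≡.refl = <.<-respʳ-≈ (sym (deriv-X*alpha m n))
      (*-pos (*-pos (natF-pos {suc m} (s≤s z≤n)) (^-pos 0<x m)) (term-pos (suc m) n))

    alpha-decreasing : ∀ {K m} → suc m ≤ℕ K → ⟦ alpha K (suc (suc m)) ⟧ < ⟦ alpha K (suc m) ⟧
    alpha-decreasing {m = m} k≤K with ℕ.m≤n⇒∃[o]m+o≡n k≤K
    ... | n , ≡.refl = <.<-respʳ-≈ (sym (alpha-step m n))
      (x<x+y (*-pos (^-pos 0<x m) (term-pos (suc m) n)))

lemma5 : ∀ {c ℓ₁ ℓ₂ : Level} (F : OrderedField c ℓ₁ ℓ₂) (K : ℕ) → 1 <ℕ K →
         let open Poly F in
         (x : Carrier) → 0# < x → x < 1# →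
         (∀ k → 1 ≤ℕ k → k ≤ℕ K → 0# < evalP (derivP (mulP X (alpha K k))) x)
         × (∀ k → 1 ≤ℕ k → k <ℕ K → evalP (alpha K (suc k)) x < evalP (alpha K k) x)
lemma5 F K _ x 0<x x<1 =
    (λ { (suc _) (s≤s z≤n) k≤K → X*alpha-deriv-pos 0<x x<1 k≤K })
  , (λ { (suc _) (s≤s z≤n) k<K → alpha-decreasing 0<x x<1 (ℕ.<⇒≤ k<K) })
  where open NegativeBinomial F x
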